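{- Suppose $G$ is an $n$-vertex simple graph with $m$ edges, and $k\ge2$ is an integer with $\chi_\ell(G)\le k$. If $m\le(k-1)n$, then $$P_\ell(G,k)\ge k^{\,n-\frac{m}{k-1}}.$$
   Context: A $k$-assignment $L$ for $G$ assigns to each vertex $v$ a set $L(v)$ of exactly $k$ colors. A proper $L$-coloring is a proper vertex coloring $f$ with $f(v)\in L(v)$ for all $v$. $\chi_\ell(G)$ (list chromatic number) is the least $k$ such that $G$ has a proper $L$-coloring for every $k$-assignment $L$. $P_\ell(G,k)$ (list color function) is the minimum, over all $k$-assignments $L$ for $G$, of the number of proper $L$-colorings of $G$. -}

module Defs where

open import Data.Nat using (ℕ; zero; suc; _≤_; _<ᵇ_; _∸_; _*_; _^_)
open import Data.Nat.Properties using (_≟_)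
open import Data.Bool using (Bool; true; false; T; _∧_)
open import Data.Fin using (Fin; toℕ; zero; suc)
open import Data.Fin.Properties using (all?)
open import Data.List using (List; []; _∷_; [_]; map; concatMap; length; filter; allFin; cartesianProduct)
open import Data.Product using (Σ; ∃; _×_; _,_; proj₁; proj₂)
open import Relation.Binary.PropositionalEquality using (_≡_)
open import Relation.Nullary using (¬_; Dec; yes; no)
open import Relation.Nullary.Decidable using (¬?; _→-dec_)
open import Function.Definitions using (Injective)

record Graph (n : ℕ) : Set where
  field
    adj    : Fin n → Fin n → Bool
    sym    : ∀ u v → adj u v ≡ adj v u
    irrefl : ∀ v → adj v v ≡ false
open Graph public

edgeCount : ∀ {n} → Graph n → ℕ
edgeCount {n} G =
  length (filter (λ p → T? (adj G (proj₁ p) (proj₂ p) ∧ (toℕ (proj₁ p) <ᵇ toℕ (proj₂ p))))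
                 (cartesianProduct (allFin n) (allFin n)))
  where
  T? : (b : Bool) → Dec (T b)
  T? true  = yes _
  T? false = no (λ ())

Proper : ∀ {n} → Graph n → (Fin n → ℕ) → Set
Proper G f = ∀ u v → T (adj G u v) → ¬ (f u ≡ f v)

proper? : ∀ {n} (G : Graph n) (f : Fin n → ℕ) → Dec (Proper G f)
proper? G f = all? (λ u → all? (λ v → T? (adj G u v) →-dec ¬? (f u ≟ f v)))
  where
  T? : (b : Bool) → Dec (T b)
  T? true  = yes _
  T? false = no (λ ())

-- A k-assignment: L(v) = image of the injective map list v : Fin k → ℕ,
-- i.e. a set of exactly k colours (colours are natural numbers).
record Assignment (n k : ℕ) : Set where
  field
    list : Fin n → Fin k → ℕ
    inj  : ∀ v → Injective _≡_ _≡_ (list v)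
open Assignment public

InLists : ∀ {n k} → Assignment n k → (Fin n → ℕ) → Set
InLists L f = ∀ v → ∃ λ i → list L v i ≡ f v

Choosable : ∀ {n} → ℕ → Graph n → Set
Choosable {n} k G = (L : Assignment n k) → Σ (Fin n → ℕ) λ f → InLists L f × Proper G f

-- χ_ℓ(G) ≤ k  :  the least k' such that G is k'-choosable is at most k,
-- i.e. some k' ≤ k makes G k'-choosable.
ListChromaticAtMost : ∀ {n} → Graph n → ℕ → Set
ListChromaticAtMost G k = ∃ λ k' → k' ≤ k × Choosable k' G

cons : ∀ {n k} → Fin k → (Fin n → Fin k) → Fin (suc n) → Fin k
cons c f zero    = c
cons c f (suc i) = f i

allFuns : ∀ n k → List (Fin n → Fin k)
allFuns zero    k = [ (λ ()) ]
allFuns (suc n) k = concatMap (λ c → map (cons c) (allFuns n k)) (allFin k)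

-- number of proper L-colourings: since each list v is injective, L-colourings
-- f (f v ∈ L(v)) correspond bijectively to index choices c : Fin n → Fin k
-- via f v = list L v (c v).
numLColorings : ∀ {n k} → Graph n → Assignment n k → ℕ
numLColorings {n} {k} G L =
  length (filter (λ c → proper? G (λ v → list L v (c v))) (allFuns n k))

module Submission where

-- Index an L-colouring by the position c v ∈ Fin k of the chosen colour in each
-- list. The proper colourings are then the points c of the grid (Fin k)ⁿ where the
-- graph polynomial g = ∏_{uv ∈ E} (x_u − x_v), evaluated at x_v = (c v-th colour
-- of L(v)), is nonzero; g has degree m, and since G is k-choosable it does not
-- vanish on the whole grid. The Alon–Füredi bound then gives N^(k−1) ≥ k^((k−1)n − m)
-- for its number N of nonzeros, by induction on n: expand g in x_1 with exponents
-- below k (possible since x_1 takes only k values), and let h be the coefficient of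
-- the largest exponent t whose coefficient does not vanish on the remaining grid.
-- Then h has degree ≤ m − t, and wherever h is nonzero g is, as a polynomial in
-- x_1, of degree t, hence nonzero at ≥ k − t of the k values of x_1. So
-- N(g) ≥ (k − t) N(h), and (k − t)^(k−1) ≥ k^(k−1−t) closes the induction.

open import Defs hiding (sym)
open import Data.Nat using (ℕ; zero; suc; _+_; _*_; _∸_; _^_; _≤_; _<_; _≤′_; _<ᵇ_; z≤n; s≤s)
open import Data.Nat.Base using (≤′-reflexive; ≤′-step)
import Data.Nat.Properties as ℕ
import Data.Nat.Tactic.RingSolver as ℕ-Solver
open import Data.Integer as ℤ using (ℤ; 0ℤ; 1ℤ; -1ℤ)
  renaming (_+_ to _+ᶻ_; _*_ to _*ᶻ_; _-_ to _-ᶻ_; -_ to -ᶻ_; _^_ to _^ᶻ_)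
import Data.Integer.Properties as ℤ
open import Data.Integer.Tactic.RingSolver using (solve-∀)
open import Data.Bool using (T; _∧_)
open import Data.Bool.Properties using (T-∧)
open import Data.Fin using (Fin; zero; suc; toℕ; inject≤)
open import Data.Fin.Properties using (toℕ-injective; inject≤-injective)
open import Data.List using (List; []; _∷_; [_]; _++_; _∷ʳ_; length; map; concat; filter; allFin; cartesianProduct; initLast; _∷ʳ′_)
import Data.List.Properties as List
open import Data.List.Relation.Unary.All as All using (All; []; _∷_)
import Data.List.Relation.Unary.All.Properties as Allₚ
open import Data.List.Relation.Unary.Any as Any using (Any; here; there)
import Data.List.Relation.Unary.Any.Properties as Anyₚ
import Data.List.Relation.Unary.AllPairs as AllPairs
open import Data.List.Relation.Unary.Unique.Propositional using (Unique)
import Data.List.Relation.Unary.Unique.Propositional.Properties as Unique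
open import Data.List.Membership.Propositional using (_∈_; lose)
open import Data.List.Membership.Propositional.Properties using (∈-allFin; ∈-filter⁺; ∈-filter⁻; ∈-cartesianProduct⁺)
open import Data.Empty using (⊥; ⊥-elim)
open import Data.Unit using (⊤; tt)
open import Data.Product using (Σ; _×_; _,_; proj₁; proj₂)
open import Data.Sum using (inj₁; inj₂)
open import Function using (_∘_; id)
open import Function.Bundles using (Equivalence)
open import Function.Definitions using (Injective)
open import Relation.Nullary using (¬_; Dec; yes; no)
open import Relation.Nullary.Decidable using (¬?; T?; decidable-stable)
open import Relation.Unary using (Decidable)
open import Relation.Binary using (tri<; tri≈; tri>)
open import Relation.Binary.PropositionalEquality hiding ([_])

private
  variable
    A B : Set

sumBy : (A → ℕ) → List A → ℕ
sumBy f []       = 0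
sumBy f (x ∷ xs) = f x + sumBy f xs

sumBy-cong : {f g : A → ℕ} (xs : List A) → All (λ x → f x ≡ g x) xs → sumBy f xs ≡ sumBy g xs
sumBy-cong []       []       = refl
sumBy-cong (x ∷ xs) (e ∷ es) = cong₂ _+_ e (sumBy-cong xs es)

sumBy-≗ : {f g : A → ℕ} → (∀ x → f x ≡ g x) → (xs : List A) → sumBy f xs ≡ sumBy g xs
sumBy-≗ f≗g xs = sumBy-cong xs (All.universal f≗g xs)

sumBy-0 : (xs : List A) → sumBy (λ _ → 0) xs ≡ 0
sumBy-0 []       = refl
sumBy-0 (x ∷ xs) = sumBy-0 xs

sumBy-++ : (f : A → ℕ) (xs ys : List A) → sumBy f (xs ++ ys) ≡ sumBy f xs + sumBy f ys
sumBy-++ f []       ys = refl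
sumBy-++ f (x ∷ xs) ys = trans (cong (f x +_) (sumBy-++ f xs ys)) (sym (ℕ.+-assoc (f x) _ _))

sumBy-concat : (f : A → ℕ) (xss : List (List A)) → sumBy f (concat xss) ≡ sumBy (sumBy f) xss
sumBy-concat f []         = refl
sumBy-concat f (xs ∷ xss) = trans (sumBy-++ f xs (concat xss)) (cong (sumBy f xs +_) (sumBy-concat f xss))

sumBy-map : (f : B → ℕ) (g : A → B) (xs : List A) → sumBy f (map g xs) ≡ sumBy (λ x → f (g x)) xs
sumBy-map f g []       = refl
sumBy-map f g (x ∷ xs) = cong (f (g x) +_) (sumBy-map f g xs)

sumBy-+ : (f g : A → ℕ) (xs : List A) → sumBy (λ x → f x + g x) xs ≡ sumBy f xs + sumBy g xs
sumBy-+ f g []       = refl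
sumBy-+ f g (x ∷ xs) = trans (cong (f x + g x +_) (sumBy-+ f g xs)) (interchange (f x) (g x) _ _)
  where
  interchange : ∀ a b c d → (a + b) + (c + d) ≡ (a + c) + (b + d)
  interchange = ℕ-Solver.solve-∀

sumBy-* : (m : ℕ) (f : A → ℕ) (xs : List A) → sumBy (λ x → m * f x) xs ≡ m * sumBy f xs
sumBy-* m f []       = sym (ℕ.*-zeroʳ m)
sumBy-* m f (x ∷ xs) = trans (cong (m * f x +_) (sumBy-* m f xs)) (sym (ℕ.*-distribˡ-+ m (f x) _))

sumBy-mono : (f g : A → ℕ) (xs : List A) → (∀ x → x ∈ xs → f x ≤ g x) → sumBy f xs ≤ sumBy g xs
sumBy-mono f g []       f≤g = z≤n
sumBy-mono f g (x ∷ xs) f≤g = ℕ.+-mono-≤ (f≤g x (here refl)) (sumBy-mono f g xs (λ y y∈ → f≤g y (there y∈)))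

sumBy-swap : (F : A → B → ℕ) (xs : List A) (ys : List B) →
  sumBy (λ x → sumBy (F x) ys) xs ≡ sumBy (λ y → sumBy (λ x → F x y) xs) ys
sumBy-swap F []       ys = sym (sumBy-0 ys)
sumBy-swap F (x ∷ xs) ys =
  trans (cong (sumBy (F x) ys +_) (sumBy-swap F xs ys)) (sym (sumBy-+ (F x) _ ys))

length-∷ʳ : (xs : List A) (x : A) → length (xs ∷ʳ x) ≡ suc (length xs)
length-∷ʳ xs x = trans (List.length-++ xs) (ℕ.+-comm (length xs) 1)

suc-^-≤ : ∀ K j → j ≤ K → suc K ^ j ≤ suc j * K ^ j
suc-^-≤ K zero    _   = s≤s z≤n
suc-^-≤ K (suc j) j<K = begin
  suc K * suc K ^ j        ≤⟨ ℕ.*-monoʳ-≤ (suc K) (suc-^-≤ K j (ℕ.<⇒≤ j<K)) ⟩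
  suc K * (suc j * K ^ j)  ≡⟨ sym (ℕ.*-assoc (suc K) (suc j) (K ^ j)) ⟩
  suc K * suc j * K ^ j    ≤⟨ ℕ.*-monoˡ-≤ (K ^ j) factors ⟩
  suc (suc j) * K * K ^ j  ≡⟨ ℕ.*-assoc (suc (suc j)) K (K ^ j) ⟩
  suc (suc j) * (K * K ^ j) ∎
  where
  open ℕ.≤-Reasoning
  lhs : ∀ K j → suc K * suc j ≡ suc j + (K + K * j)
  lhs = ℕ-Solver.solve-∀
  rhs : ∀ K j → suc (suc j) * K ≡ K + (K + K * j)
  rhs = ℕ-Solver.solve-∀
  factors : suc K * suc j ≤ suc (suc j) * K
  factors rewrite lhs K j | rhs K j = ℕ.+-monoˡ-≤ (K + K * j) j<K

-- With j = k − 1 − t this is (k − t)^(k−1) ≥ k^(k−1−t).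
suc-^-exchange : ∀ j t → suc (j + t) ^ j ≤ suc j ^ (j + t)
suc-^-exchange j zero    rewrite ℕ.+-identityʳ j = ℕ.≤-refl
suc-^-exchange j (suc t) = begin
  suc (j + suc t) ^ j         ≡⟨ cong (λ z → suc z ^ j) (ℕ.+-suc j t) ⟩
  suc (suc (j + t)) ^ j       ≤⟨ suc-^-≤ (suc (j + t)) j (ℕ.m≤n⇒m≤1+n (ℕ.m≤m+n j t)) ⟩
  suc j * suc (j + t) ^ j     ≤⟨ ℕ.*-monoʳ-≤ (suc j) (suc-^-exchange j t) ⟩
  suc j * suc j ^ (j + t)     ≡⟨ cong (suc j ^_) (sym (ℕ.+-suc j t)) ⟩
  suc j ^ (j + suc t)         ∎
  where open ℕ.≤-Reasoning

∸-split : ∀ a A d t → t ≤ a → t ≤ d → (a + A) ∸ d ≤ (a ∸ t) + (A ∸ (d ∸ t))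
∸-split a A d zero _ _ = ℕ.m≤n+o⇒m∸n≤o (a + A) d (begin
  a + A              ≤⟨ ℕ.+-monoʳ-≤ a (ℕ.m≤n+m∸n A d) ⟩
  a + (d + (A ∸ d))  ≡⟨ ℕ.+-comm a _ ⟩
  d + (A ∸ d) + a    ≡⟨ ℕ.+-assoc d _ a ⟩
  d + (A ∸ d + a)    ≡⟨ cong (d +_) (ℕ.+-comm _ a) ⟩
  d + (a + (A ∸ d))  ∎)
  where open ℕ.≤-Reasoning
∸-split (suc a) A (suc d) (suc t) (s≤s t≤a) (s≤s t≤d) = ∸-split a A d t t≤a t≤d

^-distribʳ-* : ∀ m n a → (m * n) ^ a ≡ m ^ a * n ^ a
^-distribʳ-* m n zero    = refl
^-distribʳ-* m n (suc a) = trans (cong (m * n *_) (^-distribʳ-* m n a)) (shuffle m n (m ^ a) (n ^ a))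
  where
  shuffle : ∀ m n x y → m * n * (x * y) ≡ m * x * (n * y)
  shuffle = ℕ-Solver.solve-∀

-- Here k = a + 1, t is the exponent of the leading nonvanishing coefficient h,
-- and N′ and M are the numbers of nonzeros of h and of the whole function.
alon-füredi-step : ∀ a t d n N′ M → t ≤ a → t ≤ d →
  suc a ^ (a * n ∸ (d ∸ t)) ≤ N′ ^ a → suc (a ∸ t) * N′ ≤ M →
  suc a ^ (a * suc n ∸ d) ≤ M ^ a
alon-füredi-step a t d n N′ M t≤a t≤d ih count = begin
  suc a ^ (a * suc n ∸ d)                      ≡⟨ cong (λ e → suc a ^ (e ∸ d)) (ℕ.*-suc a n) ⟩
  suc a ^ (a + a * n ∸ d)                      ≤⟨ ℕ.^-monoʳ-≤ (suc a) (∸-split a (a * n) d t t≤a t≤d) ⟩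
  suc a ^ ((a ∸ t) + (a * n ∸ (d ∸ t)))        ≡⟨ ℕ.^-distribˡ-+-* (suc a) (a ∸ t) _ ⟩
  suc a ^ (a ∸ t) * suc a ^ (a * n ∸ (d ∸ t))  ≤⟨ ℕ.*-mono-≤ exchange ih ⟩
  suc (a ∸ t) ^ a * N′ ^ a                     ≡⟨ sym (^-distribʳ-* (suc (a ∸ t)) N′ a) ⟩
  (suc (a ∸ t) * N′) ^ a                       ≤⟨ ℕ.^-monoˡ-≤ a count ⟩
  M ^ a                                        ∎
  where
  open ℕ.≤-Reasoning
  exchange : suc a ^ (a ∸ t) ≤ suc (a ∸ t) ^ a
  exchange = subst (λ b → suc b ^ (a ∸ t) ≤ suc (a ∸ t) ^ b) (ℕ.m∸n+n≡m t≤a) (suc-^-exchange (a ∸ t) t)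

nonzero : ℤ → ℕ
nonzero (ℤ.+ zero)  = 0
nonzero (ℤ.+ suc _) = 1
nonzero ℤ.-[1+ _ ]  = 1

nonzero-≢0 : ∀ x → x ≢ 0ℤ → nonzero x ≡ 1
nonzero-≢0 (ℤ.+ zero)  x≢0 = ⊥-elim (x≢0 refl)
nonzero-≢0 (ℤ.+ suc _) x≢0 = refl
nonzero-≢0 ℤ.-[1+ _ ]  x≢0 = refl

nonzero-*ˡ : ∀ x y → x ≢ 0ℤ → nonzero (x *ᶻ y) ≡ nonzero y
nonzero-*ˡ x y x≢0 with y ℤ.≟ 0ℤ
... | yes refl = cong nonzero (ℤ.*-zeroʳ x)
... | no y≢0   = trans (nonzero-≢0 (x *ᶻ y) xy≢0) (sym (nonzero-≢0 y y≢0))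
  where
  xy≢0 : x *ᶻ y ≢ 0ℤ
  xy≢0 xy≡0 with ℤ.i*j≡0⇒i≡0∨j≡0 x xy≡0
  ... | inj₁ x≡0 = x≢0 x≡0
  ... | inj₂ y≡0 = y≢0 y≡0

¬any≢0⇒all≡0 : (f : A → ℤ) (xs : List A) → ¬ Any (λ x → f x ≢ 0ℤ) xs → All (λ x → f x ≡ 0ℤ) xs
¬any≢0⇒all≡0 f xs ¬any = All.map (λ {x} → decidable-stable (f x ℤ.≟ 0ℤ)) (Allₚ.¬Any⇒All¬ xs ¬any)

any≢0? : (f : A → ℤ) (xs : List A) → Dec (Any (λ x → f x ≢ 0ℤ) xs)
any≢0? f = Any.any? (λ x → ¬? (f x ℤ.≟ 0ℤ))

-- Univariate integer polynomials, as coefficient lists with the constant term first.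
Poly : Set
Poly = List ℤ

evalPoly : Poly → ℤ → ℤ
evalPoly []      x = 0ℤ
evalPoly (a ∷ p) x = a +ᶻ x *ᶻ evalPoly p x

evalPoly-const : ∀ a x → evalPoly [ a ] x ≡ a
evalPoly-const a x = trans (cong (a +ᶻ_) (ℤ.*-zeroʳ x)) (ℤ.+-identityʳ a)

quotient : ℤ → Poly → Poly
quotient r []          = []
quotient r (a ∷ [])    = []
quotient r (a ∷ b ∷ p) = evalPoly (b ∷ p) r ∷ quotient r (b ∷ p)

factor-theorem : ∀ r p x → evalPoly p x ≡ (x -ᶻ r) *ᶻ evalPoly (quotient r p) x +ᶻ evalPoly p r
factor-theorem r []          x = nil x r
  where
  nil : ∀ x r → 0ℤ ≡ (x -ᶻ r) *ᶻ 0ℤ +ᶻ 0ℤ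
  nil = solve-∀
factor-theorem r (a ∷ [])    x = constant a x r
  where
  constant : ∀ a x r → a +ᶻ x *ᶻ 0ℤ ≡ (x -ᶻ r) *ᶻ 0ℤ +ᶻ (a +ᶻ r *ᶻ 0ℤ)
  constant = solve-∀
factor-theorem r (a ∷ b ∷ p) x rewrite factor-theorem r (b ∷ p) x =
  horner a (evalPoly (b ∷ p) r) (evalPoly (quotient r (b ∷ p)) x) x r
  where
  horner : ∀ a e q x r → a +ᶻ x *ᶻ ((x -ᶻ r) *ᶻ q +ᶻ e) ≡ (x -ᶻ r) *ᶻ (e +ᶻ x *ᶻ q) +ᶻ (a +ᶻ r *ᶻ e)
  horner = solve-∀

LeadingNonzero : Poly → Set
LeadingNonzero []          = ⊥
LeadingNonzero (a ∷ [])    = a ≢ 0ℤ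
LeadingNonzero (a ∷ b ∷ p) = LeadingNonzero (b ∷ p)

quotient-leadingNonzero : ∀ r a b p → LeadingNonzero (b ∷ p) → LeadingNonzero (quotient r (a ∷ b ∷ p))
quotient-leadingNonzero r a b []      b≢0 = b≢0 ∘ trans (sym (evalPoly-const b r))
quotient-leadingNonzero r a b (c ∷ p) lnz = quotient-leadingNonzero r b c p lnz

length-quotient : ∀ r a p → length (quotient r (a ∷ p)) ≡ length p
length-quotient r a []      = refl
length-quotient r a (b ∷ p) = cong suc (length-quotient r b p)

leadingNonzero-∷ʳ : ∀ p a → a ≢ 0ℤ → LeadingNonzero (p ∷ʳ a)
leadingNonzero-∷ʳ []          a a≢0 = a≢0
leadingNonzero-∷ʳ (b ∷ [])    a a≢0 = a≢0
leadingNonzero-∷ʳ (b ∷ c ∷ p) a a≢0 = leadingNonzero-∷ʳ (c ∷ p) a a≢0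

nonroots : Poly → List ℤ → ℕ
nonroots p = sumBy (λ y → nonzero (evalPoly p y))

nonroot-quotient : ∀ r p → evalPoly p r ≡ 0ℤ → ∀ y → r ≢ y →
  nonzero (evalPoly p y) ≡ nonzero (evalPoly (quotient r p) y)
nonroot-quotient r p p[r]≡0 y r≢y = begin
  nonzero (evalPoly p y)                  ≡⟨ cong nonzero (factor-theorem r p y) ⟩
  nonzero ((y -ᶻ r) *ᶻ q +ᶻ evalPoly p r) ≡⟨ cong (λ e → nonzero ((y -ᶻ r) *ᶻ q +ᶻ e)) p[r]≡0 ⟩
  nonzero ((y -ᶻ r) *ᶻ q +ᶻ 0ℤ)           ≡⟨ cong nonzero (ℤ.+-identityʳ _) ⟩
  nonzero ((y -ᶻ r) *ᶻ q)                 ≡⟨ nonzero-*ˡ _ q (r≢y ∘ sym ∘ ℤ.i-j≡0⇒i≡j y r) ⟩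
  nonzero q                               ∎
  where
  open ≡-Reasoning
  q = evalPoly (quotient r p) y

roots-bound : ∀ ys → Unique ys → ∀ p → LeadingNonzero p → length ys ≤ nonroots p ys + (length p ∸ 1)
roots-bound []       _                 p lnz = z≤n
roots-bound (y ∷ ys) (y∉ys AllPairs.∷ u) p lnz with evalPoly p y ℤ.≟ 0ℤ
... | no p[y]≢0 rewrite nonzero-≢0 _ p[y]≢0 = s≤s (roots-bound ys u p lnz)
roots-bound (y ∷ ys) (y∉ys AllPairs.∷ u) (a ∷ []) a≢0 | yes p[y]≡0 =
  ⊥-elim (a≢0 (trans (sym (evalPoly-const a y)) p[y]≡0))
roots-bound (y ∷ ys) (y∉ys AllPairs.∷ u) p@(a ∷ b ∷ p′) lnz | yes p[y]≡0 rewrite p[y]≡0 = begin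
  suc (length ys)                      ≤⟨ s≤s (roots-bound ys u q (quotient-leadingNonzero y a b p′ lnz)) ⟩
  suc (nonroots q ys + (length q ∸ 1)) ≡⟨ cong (λ l → suc (nonroots q ys + l)) (length-quotient y b p′) ⟩
  suc (nonroots q ys + length p′)      ≡⟨ sym (ℕ.+-suc _ _) ⟩
  nonroots q ys + suc (length p′)      ≡⟨ cong (_+ suc (length p′)) (sym same-nonroots) ⟩
  nonroots p ys + suc (length p′)      ∎
  where
  open ℕ.≤-Reasoning
  q = quotient y p
  same-nonroots : nonroots p ys ≡ nonroots q ys
  same-nonroots = sumBy-cong ys (All.map (nonroot-quotient y p p[y]≡0 _) y∉ys)

addConst : ℤ → Poly → Poly
addConst c []      = [ c ]
addConst c (d ∷ q) = c +ᶻ d ∷ q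

evalPoly-addConst : ∀ c q x → evalPoly (addConst c q) x ≡ c +ᶻ evalPoly q x
evalPoly-addConst c []      x = trans (evalPoly-const c x) (sym (ℤ.+-identityʳ c))
evalPoly-addConst c (d ∷ q) x = ℤ.+-assoc c d (x *ᶻ evalPoly q x)

length-addConst : ∀ c q {l} → length q ≤ suc l → length (addConst c q) ≤ suc l
length-addConst c []      _   = s≤s z≤n
length-addConst c (d ∷ q) q≤l = q≤l

mulByLinear : ℤ → Poly → Poly
mulByLinear a []      = []
mulByLinear a (c ∷ s) = -ᶻ a *ᶻ c ∷ addConst c (mulByLinear a s)

evalPoly-mulByLinear : ∀ a s x → evalPoly (mulByLinear a s) x ≡ (x -ᶻ a) *ᶻ evalPoly s x
evalPoly-mulByLinear a []      x = sym (ℤ.*-zeroʳ (x -ᶻ a))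
evalPoly-mulByLinear a (c ∷ s) x
  rewrite evalPoly-addConst c (mulByLinear a s) x | evalPoly-mulByLinear a s x = expand a c x (evalPoly s x)
  where
  expand : ∀ a c x e → -ᶻ a *ᶻ c +ᶻ x *ᶻ (c +ᶻ (x -ᶻ a) *ᶻ e) ≡ (x -ᶻ a) *ᶻ (c +ᶻ x *ᶻ e)
  expand = solve-∀

length-mulByLinear : ∀ a s → length (mulByLinear a s) ≤ suc (length s)
length-mulByLinear a []      = z≤n
length-mulByLinear a (c ∷ s) = s≤s (length-addConst c (mulByLinear a s) (length-mulByLinear a s))

-- Newton interpolation: p agrees on the points with its remainder modulo ∏ (x - y).
interpolate : (ys : List ℤ) (p : Poly) →
  Σ Poly λ q → length q ≤ length ys × All (λ y → evalPoly p y ≡ evalPoly q y) ys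
interpolate []       p = [] , z≤n , []
interpolate (a ∷ ys) p with interpolate ys (quotient a p)
... | s , length-s≤ , s-agrees = q , length-q≤ , agrees-at-a ∷ All.map agrees-at-y s-agrees
  where
  q = addConst (evalPoly p a) (mulByLinear a s)
  length-q≤ : length q ≤ suc (length ys)
  length-q≤ = length-addConst _ (mulByLinear a s) (ℕ.≤-trans (length-mulByLinear a s) (s≤s length-s≤))
  agrees-at-a : evalPoly p a ≡ evalPoly q a
  agrees-at-a rewrite evalPoly-addConst (evalPoly p a) (mulByLinear a s) a | evalPoly-mulByLinear a s a =
    vanish (evalPoly p a) a (evalPoly s a)
    where
    vanish : ∀ e a f → e ≡ e +ᶻ (a -ᶻ a) *ᶻ f
    vanish = solve-∀
  agrees-at-y : ∀ {y} → evalPoly (quotient a p) y ≡ evalPoly s y → evalPoly p y ≡ evalPoly q y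
  agrees-at-y {y} quotient-agrees
    rewrite evalPoly-addConst (evalPoly p a) (mulByLinear a s) y | evalPoly-mulByLinear a s y
          | factor-theorem a p y | quotient-agrees = ℤ.+-comm _ (evalPoly p a)

monomial : ℕ → Poly
monomial zero    = [ 1ℤ ]
monomial (suc j) = 0ℤ ∷ monomial j

evalPoly-monomial : ∀ j x → evalPoly (monomial j) x ≡ x ^ᶻ j
evalPoly-monomial zero    x = evalPoly-const 1ℤ x
evalPoly-monomial (suc j) x rewrite evalPoly-monomial j x = ℤ.+-identityˡ (x *ᶻ x ^ᶻ j)

evalPoly-zeros : ∀ zs x → All (_≡ 0ℤ) zs → evalPoly zs x ≡ 0ℤ
evalPoly-zeros []       x []          = refl
evalPoly-zeros (z ∷ zs) x (z≡0 ∷ zs≡0) rewrite z≡0 | evalPoly-zeros zs x zs≡0 =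
  trans (ℤ.+-identityˡ _) (ℤ.*-zeroʳ x)

evalPoly-++-zeros : ∀ p a zs x → All (_≡ 0ℤ) zs → evalPoly (p ++ a ∷ zs) x ≡ evalPoly (p ∷ʳ a) x
evalPoly-++-zeros []      a zs x zs≡0 = cong (λ e → a +ᶻ x *ᶻ e) (evalPoly-zeros zs x zs≡0)
evalPoly-++-zeros (b ∷ p) a zs x zs≡0 = cong (λ e → b +ᶻ x *ᶻ e) (evalPoly-++-zeros p a zs x zs≡0)

nonroots-lower-bound : ∀ {k} (x : Fin k → ℤ) → Injective _≡_ _≡_ x → ∀ p → LeadingNonzero p →
  k ≤ (length p ∸ 1) + sumBy (λ b → nonzero (evalPoly p (x b))) (allFin k)
nonroots-lower-bound {k} x x-inj p lnz = begin
  k                                                       ≡⟨ sym length-points ⟩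
  length points                                           ≤⟨ roots-bound points distinct p lnz ⟩
  nonroots p points + (length p ∸ 1)                      ≡⟨ ℕ.+-comm _ (length p ∸ 1) ⟩
  (length p ∸ 1) + nonroots p points                      ≡⟨ cong ((length p ∸ 1) +_) (sumBy-map _ x (allFin k)) ⟩
  (length p ∸ 1) + sumBy (λ b → nonzero (evalPoly p (x b))) (allFin k) ∎
  where
  open ℕ.≤-Reasoning
  points = map x (allFin k)
  length-points : length points ≡ k
  length-points = trans (List.length-map x (allFin k)) (List.length-tabulate id)
  distinct : Unique points
  distinct = Unique.map⁺ x-inj (Unique.allFin⁺ k)

module OnGrid (k : ℕ) where

  Grid : ℕ → Set
  Grid n = Fin n → Fin k

  GridFun : ℕ → Set
  GridFun n = Grid n → ℤ

  -- X v i is the i-th value of coordinate v.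
  Coords : ℕ → Set
  Coords n = Fin n → Fin k → ℤ

  horner : ∀ {n} → List (GridFun n) → ℤ → GridFun n
  horner hs x c = evalPoly (map (λ h → h c) hs) x

  -- DegreeBelow X δ g: on the grid, g agrees with a polynomial of total degree < δ
  -- in the values X v (c v). Bounding the degree strictly is what lets
  -- DegreesBelow, where the j-th coefficient has degree < δ ∸ j, force all
  -- coefficients beyond the degree to vanish.
  DegreeBelow  : ∀ {n} → Coords n → ℕ → GridFun n → Set
  DegreesBelow : ∀ {n} → Coords n → ℕ → List (GridFun n) → Set
  DegreeBelow {zero}  X zero    g = ∀ c → g c ≡ 0ℤ
  DegreeBelow {zero}  X (suc δ) g = ⊤
  DegreeBelow {suc n} X δ       g = Σ (List (GridFun n)) λ hs →
    DegreesBelow (X ∘ suc) δ hs × (∀ c → g c ≡ horner hs (X zero (c zero)) (c ∘ suc))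
  DegreesBelow X δ []       = ⊤
  DegreesBelow X δ (h ∷ hs) = DegreeBelow X δ h × DegreesBelow X (δ ∸ 1) hs

  degreeBelow-≡0 : ∀ {n} (X : Coords n) δ g → (∀ c → g c ≡ 0ℤ) → DegreeBelow X δ g
  degreeBelow-≡0 {zero}  X zero    g g≡0 = g≡0
  degreeBelow-≡0 {zero}  X (suc δ) g g≡0 = tt
  degreeBelow-≡0 {suc n} X δ       g g≡0 = [] , tt , g≡0

  degreeBelow-0⇒≡0  : ∀ {n} (X : Coords n) g → DegreeBelow X 0 g → ∀ c → g c ≡ 0ℤ
  degreesBelow-0⇒≡0 : ∀ {n} (X : Coords n) hs → DegreesBelow X 0 hs → ∀ x c → horner hs x c ≡ 0ℤ
  degreeBelow-0⇒≡0 {zero}  X g g≡0 = g≡0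
  degreeBelow-0⇒≡0 {suc n} X g (hs , deg-hs , g≡) c = trans (g≡ c) (degreesBelow-0⇒≡0 (X ∘ suc) hs deg-hs _ _)
  degreesBelow-0⇒≡0 X []       _              x c = refl
  degreesBelow-0⇒≡0 X (h ∷ hs) (deg-h , deg-hs) x c
    rewrite degreeBelow-0⇒≡0 X h deg-h c | degreesBelow-0⇒≡0 X hs deg-hs x c = trans (ℤ.+-identityˡ _) (ℤ.*-zeroʳ x)

  degreeBelow-≗ : ∀ {n} (X : Coords n) δ {g g′} → (∀ c → g c ≡ g′ c) → DegreeBelow X δ g → DegreeBelow X δ g′
  degreeBelow-≗ {zero}  X zero    g≗g′ g≡0 c = trans (sym (g≗g′ c)) (g≡0 c)
  degreeBelow-≗ {zero}  X (suc δ) g≗g′ _     = tt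
  degreeBelow-≗ {suc n} X δ       g≗g′ (hs , deg-hs , g≡) = hs , deg-hs , λ c → trans (sym (g≗g′ c)) (g≡ c)

  degreeBelow-suc  : ∀ {n} (X : Coords n) δ g → DegreeBelow X δ g → DegreeBelow X (suc δ) g
  degreesBelow-suc : ∀ {n} (X : Coords n) δ hs → DegreesBelow X δ hs → DegreesBelow X (suc δ) hs
  degreeBelow-suc {zero}  X δ g _ = tt
  degreeBelow-suc {suc n} X δ g (hs , deg-hs , g≡) = hs , degreesBelow-suc (X ∘ suc) δ hs deg-hs , g≡
  degreesBelow-suc X δ       []       _               = tt
  degreesBelow-suc X zero    (h ∷ hs) (deg-h , deg-hs) = degreeBelow-suc X 0 h deg-h , deg-hs
  degreesBelow-suc X (suc δ) (h ∷ hs) (deg-h , deg-hs) =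
    degreeBelow-suc X (suc δ) h deg-h , degreesBelow-suc X δ hs deg-hs

  degreeBelow-≤ : ∀ {n} (X : Coords n) {δ δ′} g → δ ≤′ δ′ → DegreeBelow X δ g → DegreeBelow X δ′ g
  degreeBelow-≤ X g (≤′-reflexive refl) deg = deg
  degreeBelow-≤ X g (≤′-step δ≤δ′)      deg = degreeBelow-suc X _ g (degreeBelow-≤ X g δ≤δ′ deg)

  degreeBelow-const : ∀ {n} (X : Coords n) δ a → DegreeBelow X (suc δ) (λ _ → a)
  degreeBelow-const {zero}  X δ a = tt
  degreeBelow-const {suc n} X δ a =
    [ (λ _ → a) ] , (degreeBelow-const (X ∘ suc) δ a , tt) , λ c → sym (evalPoly-const a (X zero (c zero)))

  addCoeffs : ∀ {n} → List (GridFun n) → List (GridFun n) → List (GridFun n)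
  addCoeffs []       gs       = gs
  addCoeffs (f ∷ fs) []       = f ∷ fs
  addCoeffs (f ∷ fs) (g ∷ gs) = (λ c → f c +ᶻ g c) ∷ addCoeffs fs gs

  horner-addCoeffs : ∀ {n} (fs gs : List (GridFun n)) x c →
    horner (addCoeffs fs gs) x c ≡ horner fs x c +ᶻ horner gs x c
  horner-addCoeffs []       gs       x c = sym (ℤ.+-identityˡ _)
  horner-addCoeffs (f ∷ fs) []       x c = sym (ℤ.+-identityʳ _)
  horner-addCoeffs (f ∷ fs) (g ∷ gs) x c rewrite horner-addCoeffs fs gs x c = interchange (f c) (g c) x _ _
    where
    interchange : ∀ a b x u v → (a +ᶻ b) +ᶻ x *ᶻ (u +ᶻ v) ≡ (a +ᶻ x *ᶻ u) +ᶻ (b +ᶻ x *ᶻ v)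
    interchange = solve-∀

  length-addCoeffs : ∀ {n} (fs gs : List (GridFun n)) {l} → length fs ≤ l → length gs ≤ l → length (addCoeffs fs gs) ≤ l
  length-addCoeffs []       gs       _         gs≤ = gs≤
  length-addCoeffs (f ∷ fs) []       fs≤       _   = fs≤
  length-addCoeffs (f ∷ fs) (g ∷ gs) (s≤s fs≤) (s≤s gs≤) = s≤s (length-addCoeffs fs gs fs≤ gs≤)

  degreeBelow-+  : ∀ {n} (X : Coords n) δ f g → DegreeBelow X δ f → DegreeBelow X δ g → DegreeBelow X δ (λ c → f c +ᶻ g c)
  degreesBelow-+ : ∀ {n} (X : Coords n) δ fs gs → DegreesBelow X δ fs → DegreesBelow X δ gs → DegreesBelow X δ (addCoeffs fs gs)
  degreeBelow-+ {zero}  X zero    f g f≡0 g≡0 c rewrite f≡0 c | g≡0 c = refl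
  degreeBelow-+ {zero}  X (suc δ) f g _   _   = tt
  degreeBelow-+ {suc n} X δ f g (fs , deg-fs , f≡) (gs , deg-gs , g≡) =
    addCoeffs fs gs , degreesBelow-+ (X ∘ suc) δ fs gs deg-fs deg-gs ,
    λ c → trans (cong₂ _+ᶻ_ (f≡ c) (g≡ c)) (sym (horner-addCoeffs fs gs _ _))
  degreesBelow-+ X δ []       gs       _                deg-gs           = deg-gs
  degreesBelow-+ X δ (f ∷ fs) []       deg-fs           _                = deg-fs
  degreesBelow-+ X δ (f ∷ fs) (g ∷ gs) (deg-f , deg-fs) (deg-g , deg-gs) =
    degreeBelow-+ X δ f g deg-f deg-g , degreesBelow-+ X (δ ∸ 1) fs gs deg-fs deg-gs

  mulCoeffs : ∀ {n} → GridFun n → List (GridFun n) → List (GridFun n)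
  mulCoeffs y = map (λ h c → y c *ᶻ h c)

  horner-mulCoeffs : ∀ {n} (y : GridFun n) hs x c → horner (mulCoeffs y hs) x c ≡ y c *ᶻ horner hs x c
  horner-mulCoeffs y []       x c = sym (ℤ.*-zeroʳ (y c))
  horner-mulCoeffs y (h ∷ hs) x c rewrite horner-mulCoeffs y hs x c = factor (y c) (h c) x _
    where
    factor : ∀ y h x e → y *ᶻ h +ᶻ x *ᶻ (y *ᶻ e) ≡ y *ᶻ (h +ᶻ x *ᶻ e)
    factor = solve-∀

  degreesBelow-0-mulCoeffs : ∀ {n} (X : Coords n) y hs → DegreesBelow X 0 hs → DegreesBelow X 0 (mulCoeffs y hs)
  degreesBelow-0-mulCoeffs X y []       _                = tt
  degreesBelow-0-mulCoeffs X y (h ∷ hs) (deg-h , deg-hs) =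
    degreeBelow-≡0 X 0 _ (λ c → trans (cong (y c *ᶻ_) (degreeBelow-0⇒≡0 X h deg-h c)) (ℤ.*-zeroʳ (y c))) ,
    degreesBelow-0-mulCoeffs X y hs deg-hs

  degreeBelow-scale  : ∀ {n} (X : Coords n) δ s g → DegreeBelow X δ g → DegreeBelow X δ (λ c → s *ᶻ g c)
  degreesBelow-scale : ∀ {n} (X : Coords n) δ s hs → DegreesBelow X δ hs → DegreesBelow X δ (mulCoeffs (λ _ → s) hs)
  degreeBelow-scale {zero}  X zero    s g g≡0 c rewrite g≡0 c = ℤ.*-zeroʳ s
  degreeBelow-scale {zero}  X (suc δ) s g _     = tt
  degreeBelow-scale {suc n} X δ       s g (hs , deg-hs , g≡) =
    mulCoeffs (λ _ → s) hs , degreesBelow-scale (X ∘ suc) δ s hs deg-hs ,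
    λ c → trans (cong (s *ᶻ_) (g≡ c)) (sym (horner-mulCoeffs (λ _ → s) hs _ _))
  degreesBelow-scale X δ s []       _                = tt
  degreesBelow-scale X δ s (h ∷ hs) (deg-h , deg-hs) =
    degreeBelow-scale X δ s h deg-h , degreesBelow-scale X (δ ∸ 1) s hs deg-hs

  degreeBelow-*var  : ∀ {n} (X : Coords n) δ v g → DegreeBelow X δ g → DegreeBelow X (suc δ) (λ c → X v (c v) *ᶻ g c)
  degreesBelow-*var : ∀ {n} (X : Coords n) δ v hs → DegreesBelow X δ hs →
    DegreesBelow X (suc δ) (mulCoeffs (λ c → X v (c v)) hs)
  degreeBelow-*var {suc n} X δ zero    g (hs , deg-hs , g≡) =
    (λ _ → 0ℤ) ∷ hs , (degreeBelow-≡0 (X ∘ suc) (suc δ) _ (λ _ → refl) , deg-hs) ,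
    λ c → trans (cong (X zero (c zero) *ᶻ_) (g≡ c)) (sym (ℤ.+-identityˡ _))
  degreeBelow-*var {suc n} X δ (suc v) g (hs , deg-hs , g≡) =
    mulCoeffs (λ c → X (suc v) (c v)) hs , degreesBelow-*var (X ∘ suc) δ v hs deg-hs ,
    λ c → trans (cong (X (suc v) (c (suc v)) *ᶻ_) (g≡ c)) (sym (horner-mulCoeffs (λ c′ → X (suc v) (c′ v)) hs _ _))
  degreesBelow-*var X δ       v []       _                = tt
  degreesBelow-*var X zero    v (h ∷ hs) (deg-h , deg-hs) =
    degreeBelow-*var X 0 v h deg-h , degreesBelow-0-mulCoeffs X (λ c → X v (c v)) hs deg-hs
  degreesBelow-*var X (suc δ) v (h ∷ hs) (deg-h , deg-hs) =
    degreeBelow-*var X (suc δ) v h deg-h , degreesBelow-*var X δ v hs deg-hs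

  differenceProduct : ∀ {n} → Coords n → List (Fin n × Fin n) → GridFun n
  differenceProduct X []             c = 1ℤ
  differenceProduct X ((u , v) ∷ es) c = (X u (c u) -ᶻ X v (c v)) *ᶻ differenceProduct X es c

  degreeBelow-differenceProduct : ∀ {n} (X : Coords n) es → DegreeBelow X (suc (length es)) (differenceProduct X es)
  degreeBelow-differenceProduct X []             = degreeBelow-const X 0 1ℤ
  degreeBelow-differenceProduct X ((u , v) ∷ es) =
    degreeBelow-≗ X _ (λ c → expand (X u (c u)) (X v (c v)) (differenceProduct X es c))
      (degreeBelow-+ X _ _ _ (degreeBelow-*var X _ u _ deg)
                             (degreeBelow-scale X _ -1ℤ _ (degreeBelow-*var X _ v _ deg)))
    where
    deg = degreeBelow-differenceProduct X es
    expand : ∀ a b p → a *ᶻ p +ᶻ -1ℤ *ᶻ (b *ᶻ p) ≡ (a -ᶻ b) *ᶻ p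
    expand = solve-∀

  horner-∷ʳ : ∀ {n} (fs : List (GridFun n)) h x c → horner (fs ∷ʳ h) x c ≡ horner fs x c +ᶻ x ^ᶻ length fs *ᶻ h c
  horner-∷ʳ []       h x c = trans (evalPoly-const (h c) x) (sym (trans (ℤ.+-identityˡ _) (ℤ.*-identityˡ (h c))))
  horner-∷ʳ (f ∷ fs) h x c rewrite horner-∷ʳ fs h x c = distrib (f c) x (horner fs x c) (x ^ᶻ length fs) (h c)
    where
    distrib : ∀ f x e p h → f +ᶻ x *ᶻ (e +ᶻ p *ᶻ h) ≡ (f +ᶻ x *ᶻ e) +ᶻ (x *ᶻ p) *ᶻ h
    distrib = solve-∀

  degreesBelow-++ : ∀ {n} (X : Coords n) δ fs gs → DegreesBelow X δ (fs ++ gs) →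
    DegreesBelow X δ fs × DegreesBelow X (δ ∸ length fs) gs
  degreesBelow-++ X δ []       gs deg-gs            = tt , deg-gs
  degreesBelow-++ X δ (f ∷ fs) gs (deg-f , deg-fsgs) with degreesBelow-++ X (δ ∸ 1) fs gs deg-fsgs
  ... | deg-fs , deg-gs = (deg-f , deg-fs) , subst (λ d → DegreesBelow X d gs) (ℕ.∸-+-assoc δ 1 (length fs)) deg-gs

  scaleByPoly : ∀ {n} → Poly → GridFun n → List (GridFun n)
  scaleByPoly r h = map (λ e c → e *ᶻ h c) r

  horner-scaleByPoly : ∀ {n} r (h : GridFun n) x c → horner (scaleByPoly r h) x c ≡ evalPoly r x *ᶻ h c
  horner-scaleByPoly []      h x c = sym (ℤ.*-zeroˡ (h c))
  horner-scaleByPoly (e ∷ r) h x c rewrite horner-scaleByPoly r h x c = distrib e (h c) x (evalPoly r x)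
    where
    distrib : ∀ e h x p → e *ᶻ h +ᶻ x *ᶻ (p *ᶻ h) ≡ (e +ᶻ x *ᶻ p) *ᶻ h
    distrib = solve-∀

  degreesBelow-scaleByPoly : ∀ {n} (X : Coords n) δ m r h → length r ≤ m → DegreeBelow X (δ ∸ m) h →
    DegreesBelow X δ (scaleByPoly r h)
  degreesBelow-scaleByPoly X δ m       []      h _           _     = tt
  degreesBelow-scaleByPoly X δ (suc m) (e ∷ r) h (s≤s r≤m) deg-h =
    degreeBelow-scale X δ e h (degreeBelow-≤ X h (ℕ.≤⇒≤′ (ℕ.m∸n≤m δ (suc m))) deg-h) ,
    degreesBelow-scaleByPoly X (δ ∸ 1) m r h r≤m (subst (λ d → DegreeBelow X d h) (sym (ℕ.∸-+-assoc δ 1 m)) deg-h)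

  module Reduction (x : Fin k → ℤ) (r : Poly) (length-r≤k : length r ≤ k)
                   (x^k≡r : ∀ b → x b ^ᶻ k ≡ evalPoly r (x b)) where

    ReducedForm : ∀ {n} → Coords n → ℕ → List (GridFun n) → Set
    ReducedForm {n} X δ hs = Σ (List (GridFun n)) λ hs′ → length hs′ ≤ k × DegreesBelow X δ hs′ ×
      (∀ b c → horner hs (x b) c ≡ horner hs′ (x b) c)

    reduceOnce : ∀ {n} (X : Coords n) δ hs → length hs ≤ suc k → DegreesBelow X δ hs → ReducedForm X δ hs
    reduceOnce X δ hs _ deg-hs with length hs ℕ.≤? k
    ... | yes hs≤k = hs , hs≤k , deg-hs , λ _ _ → refl
    reduceOnce X δ hs hs≤1+k deg-hs | no hs≰k with initLast hs
    ... | []       = ⊥-elim (hs≰k z≤n)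
    ... | fs ∷ʳ′ h = hs′ , length-hs′≤k , deg-hs′ , agrees
      where
      length-fs≡k : length fs ≡ k
      length-fs≡k = ℕ.suc-injective (trans (sym (length-∷ʳ fs h))
        (ℕ.≤-antisym hs≤1+k (ℕ.≰⇒> hs≰k)))
      hs′ = addCoeffs fs (scaleByPoly r h)
      length-hs′≤k : length hs′ ≤ k
      length-hs′≤k = length-addCoeffs fs (scaleByPoly r h) (ℕ.≤-reflexive length-fs≡k)
        (subst (_≤ k) (sym (List.length-map _ r)) length-r≤k)
      deg-split = degreesBelow-++ X δ fs [ h ] deg-hs
      deg-hs′ : DegreesBelow X δ hs′
      deg-hs′ = degreesBelow-+ X δ fs (scaleByPoly r h) (proj₁ deg-split)
        (degreesBelow-scaleByPoly X δ k r h length-r≤k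
          (subst (λ l → DegreeBelow X (δ ∸ l) h) length-fs≡k (proj₁ (proj₂ deg-split))))
      agrees : ∀ b c → horner (fs ∷ʳ h) (x b) c ≡ horner hs′ (x b) c
      agrees b c = begin
        horner (fs ∷ʳ h) (x b) c                              ≡⟨ horner-∷ʳ fs h (x b) c ⟩
        horner fs (x b) c +ᶻ x b ^ᶻ length fs *ᶻ h c          ≡⟨ cong (λ l → horner fs (x b) c +ᶻ x b ^ᶻ l *ᶻ h c) length-fs≡k ⟩
        horner fs (x b) c +ᶻ x b ^ᶻ k *ᶻ h c                  ≡⟨ cong (λ e → horner fs (x b) c +ᶻ e *ᶻ h c) (x^k≡r b) ⟩
        horner fs (x b) c +ᶻ evalPoly r (x b) *ᶻ h c          ≡⟨ cong (horner fs (x b) c +ᶻ_) (sym (horner-scaleByPoly r h (x b) c)) ⟩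
        horner fs (x b) c +ᶻ horner (scaleByPoly r h) (x b) c ≡⟨ sym (horner-addCoeffs fs (scaleByPoly r h) (x b) c) ⟩
        horner hs′ (x b) c                                    ∎
        where open ≡-Reasoning

    reduce : ∀ {n} (X : Coords n) δ hs → DegreesBelow X δ hs → ReducedForm X δ hs
    reduce X δ []       _                = [] , z≤n , tt , λ _ _ → refl
    reduce X δ (h ∷ hs) (deg-h , deg-hs) with reduce X (δ ∸ 1) hs deg-hs
    ... | hs′ , hs′≤k , deg-hs′ , agrees with reduceOnce X δ (h ∷ hs′) (s≤s hs′≤k) (deg-h , deg-hs′)
    ... | hs″ , hs″≤k , deg-hs″ , agrees′ =
      hs″ , hs″≤k , deg-hs″ , λ b c → trans (cong (λ e → h c +ᶻ x b *ᶻ e) (agrees b c)) (agrees′ b c)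

  Nonvanishing : ∀ {n} → GridFun n → Set
  Nonvanishing {n} g = Any (λ c → g c ≢ 0ℤ) (allFuns n k)

  Vanishing : ∀ {n} → GridFun n → Set
  Vanishing {n} g = All (λ c → g c ≡ 0ℤ) (allFuns n k)

  nonvanishing⇒¬degreeBelow-0 : ∀ {n} (X : Coords n) g → Nonvanishing g → ¬ DegreeBelow X 0 g
  nonvanishing⇒¬degreeBelow-0 X g nv deg with Any.satisfied nv
  ... | c , gc≢0 = gc≢0 (degreeBelow-0⇒≡0 X g deg c)

  horner-vanishing : ∀ {n} (hs : List (GridFun n)) x c → All (λ h → h c ≡ 0ℤ) hs → horner hs x c ≡ 0ℤ
  horner-vanishing hs x c hs≡0 = evalPoly-zeros _ x (Allₚ.map⁺ hs≡0)

  horner≢0⇒coefficient≢0 : ∀ {n} (hs : List (GridFun n)) x c → horner hs x c ≢ 0ℤ → Any (λ h → h c ≢ 0ℤ) hs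
  horner≢0⇒coefficient≢0 hs x c horner≢0 with any≢0? (λ h → h c) hs
  ... | yes some≢0 = some≢0
  ... | no ¬some   = ⊥-elim (horner≢0 (horner-vanishing hs x c (¬any≢0⇒all≡0 _ hs ¬some)))

  splitAtLeading : ∀ {n} (hs : List (GridFun n)) → Any Nonvanishing hs →
    Σ (List (GridFun n)) λ pre → Σ (GridFun n) λ h → Σ (List (GridFun n)) λ post →
      hs ≡ pre ++ h ∷ post × Nonvanishing h × All Vanishing post
  splitAtLeading (h ∷ hs) nv with Any.any? (λ h → any≢0? h _) hs
  ... | yes nv-hs with splitAtLeading hs nv-hs
  ...   | pre , h′ , post , hs≡ , nv-h′ , post≡0 = h ∷ pre , h′ , post , cong (h ∷_) hs≡ , nv-h′ , post≡0
  splitAtLeading (h ∷ hs) (here nv-h)  | no ¬nv-hs = [] , h , hs , refl , nv-h , All.map (¬any≢0⇒all≡0 _ _) (Allₚ.¬Any⇒All¬ hs ¬nv-hs)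
  splitAtLeading (h ∷ hs) (there nv-hs) | no ¬nv-hs = ⊥-elim (¬nv-hs nv-hs)

  slice : ∀ {n} → Fin k → List (Grid (suc n))
  slice {n} b = map (cons b) (allFuns n k)

  nonzeros : ∀ {n} → GridFun n → ℕ
  nonzeros {n} g = sumBy (nonzero ∘ g) (allFuns n k)

  nonzeros-suc : ∀ {n} (g : GridFun (suc n)) →
    nonzeros g ≡ sumBy (λ c → sumBy (λ b → nonzero (g (cons b c))) (allFin k)) (allFuns n k)
  nonzeros-suc {n} g = begin
    sumBy f (concat (map slice (allFin k)))                          ≡⟨ sumBy-concat f (map slice (allFin k)) ⟩
    sumBy (sumBy f) (map slice (allFin k))                           ≡⟨ sumBy-map (sumBy f) slice (allFin k) ⟩
    sumBy (λ b → sumBy f (slice b)) (allFin k)                       ≡⟨ sumBy-≗ (λ b → sumBy-map f (cons b) (allFuns n k)) (allFin k) ⟩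
    sumBy (λ b → sumBy (λ c → f (cons b c)) (allFuns n k)) (allFin k) ≡⟨ sumBy-swap (λ b c → f (cons b c)) (allFin k) (allFuns n k) ⟩
    sumBy (λ c → sumBy (λ b → f (cons b c)) (allFin k)) (allFuns n k) ∎
    where
    open ≡-Reasoning
    f : Grid (suc n) → ℕ
    f = nonzero ∘ g

  nonzeros-at-point : ∀ {n} (g : GridFun (suc n)) (x : Fin k → ℤ) → Injective _≡_ _≡_ x →
    ∀ pre h post c → (∀ b → g (cons b c) ≡ horner (pre ++ h ∷ post) (x b) c) → All (λ f → f c ≡ 0ℤ) post →
    (k ∸ length pre) * nonzero (h c) ≤ sumBy (λ b → nonzero (g (cons b c))) (allFin k)
  nonzeros-at-point g x x-inj pre h post c g≡ post≡0 with h c ℤ.≟ 0ℤ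
  ... | yes hc≡0 rewrite hc≡0 | ℕ.*-zeroʳ (k ∸ length pre) = z≤n
  ... | no hc≢0 rewrite nonzero-≢0 (h c) hc≢0 | ℕ.*-identityʳ (k ∸ length pre) =
    ℕ.m≤n+o⇒m∸n≤o k (length pre) (subst₂ (λ l s → k ≤ l + s) degree-p (sym same-nonzeros)
      (nonroots-lower-bound x x-inj p (leadingNonzero-∷ʳ coeffs (h c) hc≢0)))
    where
    coeffs = map (λ f → f c) pre
    p : Poly
    p = coeffs ∷ʳ h c
    degree-p : length p ∸ 1 ≡ length pre
    degree-p = trans (cong (_∸ 1) (length-∷ʳ coeffs (h c))) (List.length-map _ pre)
    same-nonzeros : sumBy (λ b → nonzero (g (cons b c))) (allFin k) ≡ sumBy (λ b → nonzero (evalPoly p (x b))) (allFin k)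
    same-nonzeros = sumBy-≗ (λ b → cong nonzero (trans (g≡ b) (trans
      (cong (λ q → evalPoly q (x b)) (List.map-++ (λ f → f c) pre (h ∷ post)))
      (evalPoly-++-zeros coeffs (h c) (map (λ f → f c) post) (x b) (Allₚ.map⁺ post≡0))))) (allFin k)

  nonzeros-leading : ∀ {n} (g : GridFun (suc n)) (x : Fin k → ℤ) → Injective _≡_ _≡_ x →
    ∀ pre h post → (∀ b c → g (cons b c) ≡ horner (pre ++ h ∷ post) (x b) c) → All Vanishing post →
    (k ∸ length pre) * nonzeros h ≤ nonzeros g
  nonzeros-leading {n} g x x-inj pre h post g≡ post≡0 = begin
    (k ∸ length pre) * nonzeros h                                       ≡⟨ sym (sumBy-* (k ∸ length pre) (nonzero ∘ h) (allFuns n k)) ⟩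
    sumBy (λ c → (k ∸ length pre) * nonzero (h c)) (allFuns n k)         ≤⟨ sumBy-mono _ _ (allFuns n k) at-point ⟩
    sumBy (λ c → sumBy (λ b → nonzero (g (cons b c))) (allFin k)) (allFuns n k) ≡⟨ sym (nonzeros-suc g) ⟩
    nonzeros g                                                          ∎
    where
    open ℕ.≤-Reasoning
    at-point : ∀ c → c ∈ allFuns n k → (k ∸ length pre) * nonzero (h c) ≤ sumBy (λ b → nonzero (g (cons b c))) (allFin k)
    at-point c c∈ = nonzeros-at-point g x x-inj pre h post c (λ b → g≡ b c) (All.map (λ f≡0 → All.lookup f≡0 c∈) post≡0)

  nonvanishing-coefficient : ∀ {n} (g : GridFun (suc n)) (x : Fin k → ℤ) hs →
    (∀ b c → g (cons b c) ≡ horner hs (x b) c) → Nonvanishing g → Any Nonvanishing hs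
  nonvanishing-coefficient {n} g x hs g≡ nv with Any.satisfied (Anyₚ.map⁻ (Anyₚ.concat⁻ (map slice (allFin k)) nv))
  ... | b , nv-b = Anyₚ.swap (Any.map (λ {c} gbc≢0 → horner≢0⇒coefficient≢0 hs (x b) c (gbc≢0 ∘ trans (g≡ b c)))
                                      (Anyₚ.map⁻ nv-b))

  -- Writing g as a polynomial in the first variable with coefficients in the
  -- others, powers x ^ k can be eliminated since x takes only k values.
  reducedExpansion : ∀ {n} (X : Coords (suc n)) δ g → DegreeBelow X δ g →
    Σ (List (GridFun n)) λ hs → length hs ≤ k × DegreesBelow (X ∘ suc) δ hs ×
      (∀ b c → g (cons b c) ≡ horner hs (X zero b) c)
  reducedExpansion X δ g (hs , deg-hs , g≡) with Reduction.reduce (X zero) r length-r≤k x^k≡r (X ∘ suc) δ hs deg-hs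
    where
    points = map (X zero) (allFin k)
    interpolation = interpolate points (monomial k)
    r = proj₁ interpolation
    length-r≤k : length r ≤ k
    length-r≤k = subst (length r ≤_) (trans (List.length-map (X zero) (allFin k)) (List.length-tabulate id))
                   (proj₁ (proj₂ interpolation))
    x^k≡r : ∀ b → X zero b ^ᶻ k ≡ evalPoly r (X zero b)
    x^k≡r b = trans (sym (evalPoly-monomial k (X zero b))) (All.lookup (Allₚ.map⁻ (proj₂ (proj₂ interpolation))) (∈-allFin b))
  ... | hs′ , hs′≤k , deg-hs′ , agrees = hs′ , hs′≤k , deg-hs′ , λ b c → trans (g≡ (cons b c)) (agrees b c)

module _ (a : ℕ) where
  open OnGrid (suc a)

  alon-füredi : ∀ {n} (X : Coords n) → (∀ v → Injective _≡_ _≡_ (X v)) → ∀ d g →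
    DegreeBelow X (suc d) g → Nonvanishing g → suc a ^ (a * n ∸ d) ≤ nonzeros g ^ a
  alon-füredi {zero} X X-inj d g deg (here g≢0)
    rewrite ℕ.*-zeroʳ a | ℕ.0∸n≡0 d | nonzero-≢0 _ g≢0 | ℕ.^-zeroˡ a = ℕ.≤-refl
  alon-füredi {suc n} X X-inj d g deg nv
    with reducedExpansion X (suc d) g deg
  ... | hs , hs≤k , deg-hs , g≡
    with splitAtLeading hs (nonvanishing-coefficient g (X zero) hs g≡ nv)
  ... | pre , h , post , refl , nv-h , post≡0 =
    alon-füredi-step a t d n (nonzeros h) (nonzeros g) t≤a t≤d
      (alon-füredi (X ∘ suc) (X-inj ∘ suc) (d ∸ t) h deg-h nv-h)
      (subst (λ m → m * nonzeros h ≤ nonzeros g) (ℕ.+-∸-assoc 1 t≤a)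
        (nonzeros-leading g (X zero) (X-inj zero) pre h post g≡ post≡0))
    where
    t = length pre
    t≤a : t ≤ a
    t≤a = ℕ.≤-pred (ℕ.≤-trans (ℕ.m<m+n t (s≤s z≤n)) (subst (_≤ suc a) (List.length-++ pre) hs≤k))
    deg-h₀ : DegreeBelow (X ∘ suc) (suc d ∸ t) h
    deg-h₀ = proj₁ (proj₂ (degreesBelow-++ (X ∘ suc) (suc d) pre (h ∷ post) deg-hs))
    t≤d : t ≤ d
    t≤d = ℕ.≤-pred (ℕ.m∸n≢0⇒n<m (λ eq → nonvanishing⇒¬degreeBelow-0 (X ∘ suc) h nv-h (subst (λ δ → DegreeBelow (X ∘ suc) δ h) eq deg-h₀)))
    deg-h : DegreeBelow (X ∘ suc) (suc (d ∸ t)) h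
    deg-h = subst (λ δ → DegreeBelow (X ∘ suc) δ h) (ℕ.+-∸-assoc 1 t≤d) deg-h₀

length-filter≡sumBy-nonzero : {P : A → Set} (P? : Decidable P) (f : A → ℤ) →
  (∀ x → P x → f x ≢ 0ℤ) → (∀ x → f x ≢ 0ℤ → P x) →
  ∀ xs → length (filter P? xs) ≡ sumBy (nonzero ∘ f) xs
length-filter≡sumBy-nonzero P? f P⇒≢0 ≢0⇒P [] = refl
length-filter≡sumBy-nonzero P? f P⇒≢0 ≢0⇒P (x ∷ xs) with P? x
... | yes Px rewrite nonzero-≢0 (f x) (P⇒≢0 x Px) =
  cong suc (length-filter≡sumBy-nonzero P? f P⇒≢0 ≢0⇒P xs)
... | no ¬Px with f x ℤ.≟ 0ℤ
...   | yes fx≡0 rewrite fx≡0 = length-filter≡sumBy-nonzero P? f P⇒≢0 ≢0⇒P xs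
...   | no fx≢0  = ⊥-elim (¬Px (≢0⇒P x fx≢0))

allFuns-complete : ∀ n k (c : Fin n → Fin k) → Any (λ c′ → ∀ i → c′ i ≡ c i) (allFuns n k)
allFuns-complete zero    k c = here (λ ())
allFuns-complete (suc n) k c =
  Anyₚ.concat⁺ (Anyₚ.map⁺ (lose (∈-allFin (c zero)) (Anyₚ.map⁺ (Any.map cons-≗ (allFuns-complete n k (c ∘ suc))))))
  where
  cons-≗ : ∀ {c′} → (∀ i → c′ i ≡ c (suc i)) → ∀ i → cons (c zero) c′ i ≡ c i
  cons-≗ c′≗c zero    = refl
  cons-≗ c′≗c (suc i) = c′≗c i

module _ {k : ℕ} where
  open OnGrid k

  Separated : ∀ {n} → Coords n → Grid n → Fin n × Fin n → Set
  Separated X c (u , v) = X u (c u) ≢ X v (c v)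

  differenceProduct-≢0 : ∀ {n} (X : Coords n) c es → All (Separated X c) es → differenceProduct X es c ≢ 0ℤ
  differenceProduct-≢0 X c []             []           ()
  differenceProduct-≢0 X c ((u , v) ∷ es) (sep ∷ seps) prod≡0 with ℤ.i*j≡0⇒i≡0∨j≡0 (X u (c u) -ᶻ X v (c v)) prod≡0
  ... | inj₁ diff≡0 = sep (ℤ.i-j≡0⇒i≡j _ _ diff≡0)
  ... | inj₂ rest≡0 = differenceProduct-≢0 X c es seps rest≡0

  differenceProduct-≢0⁻ : ∀ {n} (X : Coords n) c es → differenceProduct X es c ≢ 0ℤ → All (Separated X c) es
  differenceProduct-≢0⁻ X c []             _      = []
  differenceProduct-≢0⁻ X c ((u , v) ∷ es) prod≢0 =
    (λ same → prod≢0 (trans (cong (_*ᶻ rest) (ℤ.i≡j⇒i-j≡0 same)) (ℤ.*-zeroˡ rest))) ∷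
    differenceProduct-≢0⁻ X c es (λ rest≡0 → prod≢0 (trans (cong (diff *ᶻ_) rest≡0) (ℤ.*-zeroʳ diff)))
    where
    diff = X u (c u) -ᶻ X v (c v)
    rest = differenceProduct X es c

  -- The colours of the lists of L, as coordinates of the grid of index choices.
  coordsOf : ∀ {n} → Assignment n k → Coords n
  coordsOf L v i = ℤ.+ list L v i

  colouring : ∀ {n} → Assignment n k → Grid n → Fin n → ℕ
  colouring L c v = list L v (c v)

edges : ∀ {n} → Graph n → List (Fin n × Fin n)
edges {n} G = filter (λ p → T? (adj G (proj₁ p) (proj₂ p) ∧ (toℕ (proj₁ p) <ᵇ toℕ (proj₂ p))))
                     (cartesianProduct (allFin n) (allFin n))

edgeCount≡length-edges : ∀ {n} (G : Graph n) → edgeCount G ≡ length (edges G)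
edgeCount≡length-edges {n} G = cong length (List.filter-≐ _ _ (id , id) (cartesianProduct (allFin n) (allFin n)))

∈-edges : ∀ {n} (G : Graph n) {u v} → T (adj G u v) → toℕ u < toℕ v → (u , v) ∈ edges G
∈-edges G {u} {v} uv u<v =
  ∈-filter⁺ _ (∈-cartesianProduct⁺ (∈-allFin u) (∈-allFin v)) (Equivalence.from T-∧ (uv , ℕ.<⇒<ᵇ u<v))

∈-edges⁻ : ∀ {n} (G : Graph n) {u v} → (u , v) ∈ edges G → T (adj G u v)
∈-edges⁻ {n} G uv∈ = proj₁ (Equivalence.to T-∧ (proj₂ (∈-filter⁻ _ {xs = cartesianProduct (allFin n) (allFin n)} uv∈)))

proper-≗ : ∀ {n} (G : Graph n) {f f′ : Fin n → ℕ} → (∀ v → f v ≡ f′ v) → Proper G f → Proper G f′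
proper-≗ G f≗f′ proper u v uv same = proper u v uv (trans (f≗f′ u) (trans same (sym (f≗f′ v))))

restrict : ∀ {n k k′} → k′ ≤ k → Assignment n k → Assignment n k′
restrict k′≤k L = record
  { list = λ v i → list L v (inject≤ i k′≤k)
  ; inj  = λ v {i} {j} same → inject≤-injective k′≤k k′≤k i j (inj L v same)
  }

module _ {k : ℕ} {n : ℕ} (G : Graph n) (L : Assignment n k) where
  open OnGrid k

  proper⇒separated : ∀ c → Proper G (colouring L c) → All (Separated (coordsOf L) c) (edges G)
  proper⇒separated c proper = All.tabulate λ {(u , v)} uv∈ same → proper u v (∈-edges⁻ G uv∈) (ℤ.+-injective same)

  separated⇒proper : ∀ c → All (Separated (coordsOf L) c) (edges G) → Proper G (colouring L c)
  separated⇒proper c separated u v uv same with ℕ.<-cmp (toℕ u) (toℕ v)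
  ... | tri< u<v _ _ = All.lookup separated (∈-edges G uv u<v) (cong ℤ.+_ same)
  ... | tri> _ _ v<u = All.lookup separated (∈-edges G (subst T (Graph.sym G u v) uv) v<u) (cong ℤ.+_ (sym same))
  ... | tri≈ _ u≡v _ with toℕ-injective u≡v
  ...   | refl = subst T (irrefl G u) uv

  numLColorings≡nonzeros : numLColorings G L ≡ nonzeros (differenceProduct (coordsOf L) (edges G))
  numLColorings≡nonzeros = length-filter≡sumBy-nonzero (λ c → proper? G (colouring L c)) _
    (λ c → differenceProduct-≢0 (coordsOf L) c (edges G) ∘ proper⇒separated c)
    (λ c → separated⇒proper c ∘ differenceProduct-≢0⁻ (coordsOf L) c (edges G))
    (allFuns n k)

  -- Restricting L to lists of length k′ yields a proper colouring, i.e. a grid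
  -- point where the graph polynomial is nonzero.
  choosable⇒nonvanishing : ∀ {k′} → k′ ≤ k → Choosable k′ G → Nonvanishing (differenceProduct (coordsOf L) (edges G))
  choosable⇒nonvanishing k′≤k choosable with choosable (restrict k′≤k L)
  ... | f , f∈L , proper-f = Any.map nonvanishing-at (allFuns-complete n k c₀)
    where
    c₀ : Grid n
    c₀ v = inject≤ (proj₁ (f∈L v)) k′≤k
    nonvanishing-at : ∀ {c} → (∀ v → c v ≡ c₀ v) → differenceProduct (coordsOf L) (edges G) c ≢ 0ℤ
    nonvanishing-at {c} c≗c₀ = differenceProduct-≢0 (coordsOf L) c (edges G) (proper⇒separated c
      (proper-≗ G (λ v → sym (trans (cong (list L v) (c≗c₀ v)) (proj₂ (f∈L v)))) proper-f))

proposition3p2 :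
    (n m k : ℕ) (G : Graph n) →
    edgeCount G ≡ m → 2 ≤ k → ListChromaticAtMost G k →
    m ≤ (k ∸ 1) * n →
    (L : Assignment n k) →
    k ^ ((k ∸ 1) * n ∸ m) ≤ numLColorings G L ^ (k ∸ 1)
proposition3p2 n m zero G _ () _ _ _
proposition3p2 n .(edgeCount G) (suc a) G refl _ (k′ , k′≤k , choosable) _ L =
  subst (λ N → suc a ^ (a * n ∸ edgeCount G) ≤ N ^ a) (sym (numLColorings≡nonzeros G L))
    (alon-füredi a X (λ v → inj L v ∘ ℤ.+-injective) (edgeCount G) g degree (choosable⇒nonvanishing G L k′≤k choosable))
  where
  open OnGrid (suc a)
  X = coordsOf L
  g = differenceProduct X (edges G)
  degree : DegreeBelow X (suc (edgeCount G)) g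
  degree = subst (λ e → DegreeBelow X (suc e) g) (sym (edgeCount≡length-edges G)) (degreeBelow-differenceProduct X (edges G))
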